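{- Let $G=(U,V;E)$ be a finite bipartite graph with edge weights $w\colon E\to\mathbb{R}$ such that distinct matchings of $G$ have distinct total weights. For $U'\subseteq U$, let $\mathrm{MM}(G,w;U')$ be the unique maximum-weight matching in the induced subgraph $G[U'\cup V]$, and define $F\colon 2^U\to 2^V$ by $F(U')=\{v\in V\mid (u,v)\in \mathrm{MM}(G,w;U')\text{ for some }u\}$. Then: (a) if $U_2\subseteq U_1\subseteq U$, then $F(U_2)\subseteq F(U_1)$; (b) if $U_2\subseteq U_1\subseteq U$ and $|F(U_1)|=|U_1|$, then $|F(U_2)|=|U_2|$.
   Context: A matching is a set of edges no two of which share a vertex; its weight is the sum of the weights of its edges. For $X\subseteq U\cup V$, $G[X]$ denotes the bipartite graph on $U\cap X$, $V\cap X$ with the edges of $E$ having both ends in $X$. The assumption that all matchings have distinct weights guarantees that the maximum-weight matching in $G[U'\cup V]$ is unique. -}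

module Defs where

open import Level using (Level; _⊔_) renaming (suc to lsuc)
open import Data.Bool using (Bool; true; false; _∨_; if_then_else_; T)
open import Data.Nat using (ℕ; zero; suc)
open import Data.Fin using (Fin; zero; suc)
open import Data.Fin.Subset using (Subset; _∈_)
open import Data.Vec using (tabulate)
open import Data.Product using (_×_)
open import Relation.Binary.Core using (Rel)
open import Relation.Binary.Structures using (IsStrictTotalOrder)
open import Relation.Binary.PropositionalEquality using (_≡_)
open import Relation.Nullary using (¬_)
open import Algebra.Bundles using (AbelianGroup)

-- Totally ordered abelian groups (ℝ with + and < is one).  Weights are taken
-- in an arbitrary such group; this generalises real weights.
record OrderedAbelianGroup (c ℓ₁ ℓ₂ : Level) : Set (lsuc (c ⊔ ℓ₁ ⊔ ℓ₂)) where
  field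
    abelianGroup : AbelianGroup c ℓ₁
  open AbelianGroup abelianGroup public
  field
    _<_                : Rel Carrier ℓ₂
    isStrictTotalOrder : IsStrictTotalOrder _≈_ _<_
    ∙-monoˡ-<          : ∀ z {x y} → x < y → (x ∙ z) < (y ∙ z)

-- A finite bipartite graph G = (U, V; E) with U = Fin m, V = Fin n is given by
-- its (decidable) edge relation E : Fin m → Fin n → Bool.
-- A set of edges is likewise a Bool-valued relation.
EdgeSet : ℕ → ℕ → Set
EdgeSet m n = Fin m → Fin n → Bool

IsMatchingIn : ∀ {m n} → EdgeSet m n → Subset m → EdgeSet m n → Set
IsMatchingIn {m} {n} E U' M =
  (∀ u v → T (M u v) → T (E u v)) ×
  (∀ u v → T (M u v) → u ∈ U') ×
  (∀ u v v' → T (M u v) → T (M u v') → v ≡ v') ×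
  (∀ u u' v → T (M u v) → T (M u' v) → u ≡ u')

full : ∀ m → Subset m
full m = tabulate (λ _ → true)

IsMatching : ∀ {m n} → EdgeSet m n → EdgeSet m n → Set
IsMatching {m} E M = IsMatchingIn E (full m) M

anyFin : ∀ {k} → (Fin k → Bool) → Bool
anyFin {zero}  f = false
anyFin {suc k} f = f zero ∨ anyFin (λ i → f (suc i))

covered : ∀ {m n} → EdgeSet m n → Subset n
covered M = tabulate (λ v → anyFin (λ u → M u v))

module _ {c ℓ₁ ℓ₂} (W : OrderedAbelianGroup c ℓ₁ ℓ₂) where
  open OrderedAbelianGroup W

  sumFin : ∀ {k} → (Fin k → Carrier) → Carrier
  sumFin {zero}  f = ε
  sumFin {suc k} f = f zero ∙ sumFin (λ i → f (suc i))

  weight : ∀ {m n} → (Fin m → Fin n → Carrier) → EdgeSet m n → Carrier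
  weight w M = sumFin (λ u → sumFin (λ v → if M u v then w u v else ε))

  DistinctWeights : ∀ {m n} → EdgeSet m n → (Fin m → Fin n → Carrier) → Set (ℓ₁)
  DistinctWeights E w = ∀ M M' → IsMatching E M → IsMatching E M' →
    weight w M ≈ weight w M' → ∀ u v → M u v ≡ M' u v

  -- M is a maximum-weight matching of G[U' ∪ V] (= MM(G,w;U') under DistinctWeights).
  IsMaxWeightMatching : ∀ {m n} → EdgeSet m n → (Fin m → Fin n → Carrier) →
                        Subset m → EdgeSet m n → Set ℓ₂
  IsMaxWeightMatching E w U' M =
    IsMatchingIn E U' M × (∀ M' → IsMatchingIn E U' M' → ¬ (weight w M < weight w M'))

-- If S is a set of left vertices that is closed under alternating M₁/M₂ paths and
-- whose M₁-matched vertices lie in U₂, then exchanging M₁ and M₂ on S yields matchings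
-- of G[U₁ ∪ V] and G[U₂ ∪ V] of the same total weight.  Neither can beat its
-- maximum, so M₁ keeps its weight, and by distinctness of weights M₁ and M₂ agree on
-- S.  Applied to the alternating component of an M₂-edge whose right end M₁ misses
-- this gives (a); applied to a vertex of U₂ matched by M₁ (every vertex of U₁ is,
-- when |F(U₁)| = |U₁|) but not by M₂ it gives (b).
module Submission where

open import Defs
open import Data.Fin using (Fin)
open import Data.Fin.Subset using (Subset; _⊆_; ∣_∣)
open import Data.Product using (_×_)
open import Relation.Binary.PropositionalEquality using (_≡_)

open import Level using (Level)
open import Function using (_∘_; _⇔_; mk⇔; Equivalence)
open import Data.Bool using (Bool; true; false; T; if_then_else_)
open import Data.Bool.Properties using (T-∨; T-≡) renaming (_≟_ to _≟ᵇ_)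
open import Data.Nat using (ℕ; zero; suc)
open import Data.Nat.Properties using (+-0-commutativeMonoid; <⇒≢)
open import Data.Fin using (zero; suc)
open import Data.Fin.Properties using (suc-injective)
open import Data.Fin.Subset using (_∈_)
open import Data.Fin.Subset.Properties using (_∈?_; ⊆-antisym; p⊂q⇒∣p∣<∣q∣)
open import Data.Vec using (tabulate)
open import Data.Vec.Properties using (lookup∘tabulate; []=⇒lookup; lookup⇒[]=)
open import Data.Product using (∃; _,_; proj₁; proj₂)
open import Data.Sum using (_⊎_; inj₁; inj₂)
open import Relation.Nullary using (¬_; yes; no; does; contradiction)
open import Relation.Nullary.Decidable using (decidable-stable; ¬¬-excluded-middle)
open import Relation.Unary using (Pred; Decidable)
open import Relation.Binary.PropositionalEquality
  using (refl; sym; trans; cong; cong₂; subst; module ≡-Reasoning)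
open import Relation.Binary.Definitions using (tri<; tri≈; tri>)
open import Relation.Binary.Structures using (IsStrictTotalOrder)
import Relation.Binary.Reasoning.Setoid as ≈-Reasoning
import Algebra.Properties.CommutativeMonoid.Sum as Sum

private
  variable
    ℓ : Level
    k m n : ℕ

open Equivalence using (to; from)

T-anyFin : {f : Fin k → Bool} → T (anyFin f) ⇔ ∃ λ i → T (f i)
T-anyFin {k} = mk⇔ (sound k) (λ (i , p) → complete i p)
  where
  sound : ∀ k {f : Fin k → Bool} → T (anyFin f) → ∃ λ i → T (f i)
  sound (suc k) h with to T-∨ h
  ... | inj₁ p = zero , p
  ... | inj₂ p = let i , q = sound k p in suc i , q
  complete : ∀ {k} {f : Fin k → Bool} i → T (f i) → T (anyFin f)
  complete zero    p = from T-∨ (inj₁ p)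
  complete (suc i) p = from T-∨ (inj₂ (complete i p))

∈-tabulate : {f : Fin k → Bool} {x : Fin k} → x ∈ tabulate f ⇔ T (f x)
∈-tabulate {f = f} {x} = mk⇔
  (λ x∈ → from T-≡ (trans (sym (lookup∘tabulate f x)) ([]=⇒lookup x∈)))
  (λ fx → lookup⇒[]= x (tabulate f) (trans (lookup∘tabulate f x) (to T-≡ fx)))

dom : EdgeSet m n → Subset m
dom M = tabulate (λ u → anyFin (M u))

∈-covered : {M : EdgeSet m n} {v : Fin n} → v ∈ covered M ⇔ ∃ λ u → T (M u v)
∈-covered = mk⇔ (to T-anyFin ∘ to ∈-tabulate) (from ∈-tabulate ∘ from T-anyFin)

∈-dom : {M : EdgeSet m n} {u : Fin m} → u ∈ dom M ⇔ ∃ λ v → T (M u v)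
∈-dom = mk⇔ (to T-anyFin ∘ to ∈-tabulate) (from ∈-tabulate ∘ from T-anyFin)

dom⊆ : {E M : EdgeSet m n} {U : Subset m} → IsMatchingIn E U M → dom M ⊆ U
dom⊆ (_ , ⊆U , _) u∈ = let v , p = to ∈-dom u∈ in ⊆U _ v p

isMatchingIn⇒isMatching : {E M : EdgeSet m n} {U : Subset m} →
                          IsMatchingIn E U M → IsMatching E M
isMatchingIn⇒isMatching (⊆E , _ , rows , cols) =
  ⊆E , (λ _ _ _ → from ∈-tabulate _) , rows , cols

open Sum +-0-commutativeMonoid using (∑-comm; sum-cong-≗; sum-syntax) renaming (sum to ∑ℕ)

indicator : Bool → ℕ
indicator true  = 1
indicator false = 0

∣tabulate∣ : (f : Fin k → Bool) → ∣ tabulate f ∣ ≡ ∑ℕ (indicator ∘ f)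
∣tabulate∣ {zero}  f = refl
∣tabulate∣ {suc k} f with f zero
... | true  = cong suc (∣tabulate∣ (f ∘ suc))
... | false = ∣tabulate∣ (f ∘ suc)

indicator-anyFin : (f : Fin k → Bool) → (∀ i j → T (f i) → T (f j) → i ≡ j) →
                   indicator (anyFin f) ≡ ∑ℕ (indicator ∘ f)
indicator-anyFin {zero}  f unique = refl
indicator-anyFin {suc k} f unique
  with f zero in f0
     | indicator-anyFin (f ∘ suc) (λ i j p q → suc-injective (unique (suc i) (suc j) p q))
... | false | ih = ih
... | true  | ih = cong suc (trans none ih)
  where
  none : 0 ≡ indicator (anyFin (f ∘ suc))
  none with anyFin (f ∘ suc) in any
  ... | false = refl
  ... | true  with i , p ← to T-anyFin (from T-≡ any)
              with () ← unique zero (suc i) (from T-≡ f0) p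

∣covered∣≡∣dom∣ : {E M : EdgeSet m n} {U : Subset m} →
                  IsMatchingIn E U M → ∣ covered M ∣ ≡ ∣ dom M ∣
∣covered∣≡∣dom∣ {m} {n} {M = M} (_ , _ , rows , cols) = begin
  ∣ covered M ∣                               ≡⟨ ∣tabulate∣ (λ v → anyFin (λ u → M u v)) ⟩
  ∑[ v < n ] indicator (anyFin (λ u → M u v)) ≡⟨ sum-cong-≗ (λ v → indicator-anyFin _ (λ u u′ → cols u u′ v)) ⟩
  ∑[ v < n ] ∑[ u < m ] indicator (M u v)     ≡⟨ ∑-comm (λ u v → indicator (M u v)) ⟨
  ∑[ u < m ] ∑[ v < n ] indicator (M u v)     ≡⟨ sum-cong-≗ (λ u → indicator-anyFin (M u) (rows u)) ⟨
  ∑[ u < m ] indicator (anyFin (M u))         ≡⟨ ∣tabulate∣ (λ u → anyFin (M u)) ⟨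
  ∣ dom M ∣                                   ∎
  where open ≡-Reasoning

⊆∧∣≡∣⇒⊇ : {p q : Subset n} → p ⊆ q → ∣ p ∣ ≡ ∣ q ∣ → q ⊆ p
⊆∧∣≡∣⇒⊇ {p = p} p⊆q ∣p∣≡∣q∣ {x} x∈q with x ∈? p
... | yes x∈p = x∈p
... | no  x∉p = contradiction ∣p∣≡∣q∣ (<⇒≢ (p⊂q⇒∣p∣<∣q∣ (p⊆q , x , x∈q , x∉p)))

∣covered∣≡∣U∣⇒U⊆dom : {E M : EdgeSet m n} {U : Subset m} →
                      IsMatchingIn E U M → ∣ covered M ∣ ≡ ∣ U ∣ → U ⊆ dom M
∣covered∣≡∣U∣⇒U⊆dom matching ∣covered∣≡∣U∣ =
  ⊆∧∣≡∣⇒⊇ (dom⊆ matching) (trans (sym (∣covered∣≡∣dom∣ matching)) ∣covered∣≡∣U∣)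

U⊆dom⇒∣covered∣≡∣U∣ : {E M : EdgeSet m n} {U : Subset m} →
                      IsMatchingIn E U M → U ⊆ dom M → ∣ covered M ∣ ≡ ∣ U ∣
U⊆dom⇒∣covered∣≡∣U∣ matching U⊆dom =
  trans (∣covered∣≡∣dom∣ matching) (cong ∣_∣ (⊆-antisym (dom⊆ matching) U⊆dom))

exchange : {S : Pred (Fin m) ℓ} → Decidable S → EdgeSet m n → EdgeSet m n → EdgeSet m n
exchange S? A B u v = if does (S? u) then B u v else A u v

module _ {S : Pred (Fin m) ℓ} (S? : Decidable S) where

  exchange-on : {A B : EdgeSet m n} {u : Fin m} → S u → ∀ v → exchange S? A B u v ≡ B u v
  exchange-on {u = u} s v with S? u
  ... | yes _  = refl
  ... | no  ¬s = contradiction s ¬s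

  T-exchange : {A B : EdgeSet m n} {u : Fin m} {v : Fin n} →
               T (exchange S? A B u v) → (S u × T (B u v)) ⊎ (¬ S u × T (A u v))
  T-exchange {u = u} h with S? u
  ... | yes s  = inj₁ (s , h)
  ... | no  ¬s = inj₂ (¬s , h)

  exchange-isMatchingIn : {E A B : EdgeSet m n} {UA UB : Subset m} →
    IsMatchingIn E UA A → IsMatchingIn E UB B →
    (∀ {u v} → S u → T (B u v) → u ∈ UA) →
    (∀ {u v u′} → S u → T (B u v) → T (A u′ v) → S u′) →
    IsMatchingIn E UA (exchange S? A B)
  exchange-isMatchingIn {E = E} {A = A} {B = B} {UA = UA}
    (A⊆E , A⊆UA , rowsA , colsA) (B⊆E , _ , rowsB , colsB) B∩S⊆UA closed =
    ⊆E , ⊆UA , rows , cols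
    where
    C = exchange S? A B
    view : ∀ {u v} → T (C u v) → (S u × T (B u v)) ⊎ (¬ S u × T (A u v))
    view = T-exchange {A = A} {B = B}
    ⊆E : ∀ u v → T (C u v) → T (E u v)
    ⊆E u v h with view h
    ... | inj₁ (_ , p) = B⊆E u v p
    ... | inj₂ (_ , p) = A⊆E u v p
    ⊆UA : ∀ u v → T (C u v) → u ∈ UA
    ⊆UA u v h with view h
    ... | inj₁ (s , p) = B∩S⊆UA s p
    ... | inj₂ (_ , p) = A⊆UA u v p
    rows : ∀ u v v′ → T (C u v) → T (C u v′) → v ≡ v′
    rows u v v′ h h′ with view h | view h′
    ... | inj₁ (_ , p)  | inj₁ (_ , q)  = rowsB u v v′ p q
    ... | inj₂ (_ , p)  | inj₂ (_ , q)  = rowsA u v v′ p q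
    ... | inj₁ (s , _)  | inj₂ (¬s , _) = contradiction s ¬s
    ... | inj₂ (¬s , _) | inj₁ (s , _)  = contradiction s ¬s
    cols : ∀ u u′ v → T (C u v) → T (C u′ v) → u ≡ u′
    cols u u′ v h h′ with view h | view h′
    ... | inj₁ (_ , p)  | inj₁ (_ , q)   = colsB u u′ v p q
    ... | inj₂ (_ , p)  | inj₂ (_ , q)   = colsA u u′ v p q
    ... | inj₁ (s , p)  | inj₂ (¬s′ , q) = contradiction (closed s p q) ¬s′
    ... | inj₂ (¬s , p) | inj₁ (s′ , q)  = contradiction (closed s′ q p) ¬s

module _ {c ℓ₁ ℓ₂} (W : OrderedAbelianGroup c ℓ₁ ℓ₂) where
  open OrderedAbelianGroup W
    using ( Carrier; _≈_; _∙_; ε; _<_; comm; ∙-congˡ; ∙-monoˡ-<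
          ; isStrictTotalOrder; setoid; commutativeMonoid )
    renaming (refl to ≈-refl; sym to ≈-sym)
  open IsStrictTotalOrder isStrictTotalOrder
    using (compare; irrefl; <-respʳ-≈; <-respˡ-≈) renaming (trans to <-trans)
  open Sum commutativeMonoid using (∑-distrib-+; sum-cong-≋) renaming (sum to ∑)

  ∙-monoʳ-< : ∀ z {x y} → x < y → (z ∙ x) < (z ∙ y)
  ∙-monoʳ-< z x<y = <-respʳ-≈ (comm _ z) (<-respˡ-≈ (comm _ z) (∙-monoˡ-< z x<y))

  ∙-mono-<-≮ : ∀ {x x′ y y′} → x′ < x → ¬ (y < y′) → (x′ ∙ y′) < (x ∙ y)
  ∙-mono-<-≮ {x} {x′} {y} {y′} x′<x y≮y′ with compare y y′
  ... | tri< y<y′ _ _ = contradiction y<y′ y≮y′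
  ... | tri≈ _ y≈y′ _ = <-respʳ-≈ (∙-congˡ (≈-sym y≈y′)) (∙-monoˡ-< y′ x′<x)
  ... | tri> _ _ y′<y = <-trans (∙-monoˡ-< y′ x′<x) (∙-monoʳ-< x y′<y)

  ≮-∙-≈⇒≈ : ∀ {x x′ y y′} → ¬ (x < x′) → ¬ (y < y′) → x ∙ y ≈ x′ ∙ y′ → x ≈ x′
  ≮-∙-≈⇒≈ {x} {x′} x≮x′ y≮y′ xy≈x′y′ with compare x x′
  ... | tri< x<x′ _ _ = contradiction x<x′ x≮x′
  ... | tri≈ _ x≈x′ _ = x≈x′
  ... | tri> _ _ x′<x = contradiction (∙-mono-<-≮ x′<x y≮y′) (irrefl (≈-sym xy≈x′y′))

  sumFin≡∑ : (f : Fin k → Carrier) → sumFin W f ≡ ∑ f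
  sumFin≡∑ {zero}  f = refl
  sumFin≡∑ {suc k} f = cong (f zero ∙_) (sumFin≡∑ (f ∘ suc))

  rowWeight : (Fin m → Fin n → Carrier) → EdgeSet m n → Fin m → Carrier
  rowWeight w M u = sumFin W (λ v → if M u v then w u v else ε)

  module _ (w : Fin m → Fin n → Carrier) {S : Pred (Fin m) ℓ} (S? : Decidable S)
           (A B : EdgeSet m n) where

    rowWeight-exchange : ∀ u → rowWeight w (exchange S? A B) u ∙ rowWeight w (exchange S? B A) u
                               ≈ rowWeight w A u ∙ rowWeight w B u
    rowWeight-exchange u with does (S? u)
    ... | true  = comm _ _
    ... | false = ≈-refl

    weight-exchange : weight W w (exchange S? A B) ∙ weight W w (exchange S? B A)
                      ≈ weight W w A ∙ weight W w B
    weight-exchange = begin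
      weight W w A′ ∙ weight W w B′ ≡⟨ cong₂ _∙_ (sumFin≡∑ (row A′)) (sumFin≡∑ (row B′)) ⟩
      ∑ (row A′) ∙ ∑ (row B′)       ≈⟨ ∑-distrib-+ (row A′) (row B′) ⟨
      ∑ (λ u → row A′ u ∙ row B′ u) ≈⟨ sum-cong-≋ rowWeight-exchange ⟩
      ∑ (λ u → row A u ∙ row B u)   ≈⟨ ∑-distrib-+ (row A) (row B) ⟩
      ∑ (row A) ∙ ∑ (row B)         ≡⟨ cong₂ _∙_ (sumFin≡∑ (row A)) (sumFin≡∑ (row B)) ⟨
      weight W w A ∙ weight W w B   ∎
      where
      open ≈-Reasoning setoid
      A′ = exchange S? A B
      B′ = exchange S? B A
      row = rowWeight w

¬¬-decidable : (P : Pred (Fin k) ℓ) → ¬ ¬ Decidable P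
¬¬-decidable {zero}  P ¬dec = ¬dec (λ ())
¬¬-decidable {suc k} P ¬dec =
  ¬¬-excluded-middle λ P0? → ¬¬-decidable (P ∘ suc) λ P∘suc? →
    ¬dec λ { zero → P0? ; (suc i) → P∘suc? i }

module MaxWeightMatchings {c ℓ₁ ℓ₂} (W : OrderedAbelianGroup c ℓ₁ ℓ₂) {m n : ℕ}
  {E : EdgeSet m n} {w : Fin m → Fin n → OrderedAbelianGroup.Carrier W}
  (distinct : DistinctWeights W E w)
  {U₁ U₂ : Subset m} {M₁ M₂ : EdgeSet m n}
  (max₁ : IsMaxWeightMatching W E w U₁ M₁) (max₂ : IsMaxWeightMatching W E w U₂ M₂)
  (U₂⊆U₁ : U₂ ⊆ U₁) where

  open OrderedAbelianGroup W using (_≈_) renaming (sym to ≈-sym)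

  private
    matching₁ = proj₁ max₁
    matching₂ = proj₁ max₂
    M₂⊆U₂ = proj₁ (proj₂ matching₂)
    rows₂ = proj₁ (proj₂ (proj₂ matching₂))
    cols₁ = proj₂ (proj₂ (proj₂ matching₁))

  agree-on-exchangeable : {S : Pred (Fin m) ℓ} (S? : Decidable S) →
    (∀ {u v} → S u → T (M₁ u v) → u ∈ U₂) →
    (∀ {u v u′} → S u → T (M₂ u v) → T (M₁ u′ v) → S u′) →
    (∀ {u v u′} → S u → T (M₁ u v) → T (M₂ u′ v) → S u′) →
    ∀ {u} → S u → ∀ v → M₁ u v ≡ M₂ u v
  agree-on-exchangeable S? M₁∩S⊆U₂ closed₂₁ closed₁₂ s v = begin
    M₁ _ v  ≡⟨ distinct M₁ M₁′ (isMatchingIn⇒isMatching matching₁)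
                                (isMatchingIn⇒isMatching matching₁′) M₁≈M₁′ _ v ⟩
    M₁′ _ v ≡⟨ exchange-on S? {A = M₁} {B = M₂} s v ⟩
    M₂ _ v  ∎
    where
    open ≡-Reasoning
    M₁′ = exchange S? M₁ M₂
    M₂′ = exchange S? M₂ M₁
    matching₁′ : IsMatchingIn E U₁ M₁′
    matching₁′ =
      exchange-isMatchingIn S? matching₁ matching₂ (λ _ p → U₂⊆U₁ (M₂⊆U₂ _ _ p)) closed₂₁
    matching₂′ : IsMatchingIn E U₂ M₂′
    matching₂′ = exchange-isMatchingIn S? matching₂ matching₁ M₁∩S⊆U₂ closed₁₂
    M₁≈M₁′ : weight W w M₁ ≈ weight W w M₁′
    M₁≈M₁′ = ≮-∙-≈⇒≈ W (proj₂ max₁ M₁′ matching₁′) (proj₂ max₂ M₂′ matching₂′)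
                        (≈-sym (weight-exchange W w S? M₁ M₂))

  data Reachable (Start : Pred (Fin m) ℓ) : Pred (Fin m) ℓ where
    start : ∀ {u} → Start u → Reachable Start u
    step  : ∀ {u v u′} → Reachable Start u → T (M₁ u v) → T (M₂ u′ v) → Reachable Start u′

  -- Reachability need not be decidable constructively, but the goal is an equation
  -- of Booleans, hence stable under double negation.
  agree-from : {Start : Pred (Fin m) ℓ} →
    (∀ {u} → Start u → u ∈ U₂) →
    (∀ {u v u′} → Start u → T (M₂ u v) → ¬ T (M₁ u′ v)) →
    ∀ {u} → Start u → ∀ v → M₁ u v ≡ M₂ u v
  agree-from {Start = Start} Start⊆U₂ unmatched s v =
    decidable-stable (M₁ _ v ≟ᵇ M₂ _ v) λ M₁≢M₂ →
      ¬¬-decidable (Reachable Start) λ Reachable? →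
        M₁≢M₂ (agree-on-exchangeable Reachable? Reachable⊆U₂ closed₂₁ step (start s) v)
    where
    Reachable⊆U₂ : ∀ {u v} → Reachable Start u → T (M₁ u v) → u ∈ U₂
    Reachable⊆U₂ (start s)    _ = Start⊆U₂ s
    Reachable⊆U₂ (step _ _ p) _ = M₂⊆U₂ _ _ p
    closed₂₁ : ∀ {u v u′} → Reachable Start u → T (M₂ u v) → T (M₁ u′ v) → Reachable Start u′
    closed₂₁ (start s)      p q = contradiction q (unmatched s p)
    closed₂₁ (step r p′ q′) p q
      with refl ← rows₂ _ _ _ q′ p
      with refl ← cols₁ _ _ _ p′ q = r

  covered-mono : covered M₂ ⊆ covered M₁
  covered-mono {v} v∈F₂ with v ∈? covered M₁
  ... | yes v∈F₁ = v∈F₁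
  ... | no  v∉F₁ = contradiction (from (∈-covered {M = M₁}) (u , subst T (sym M₁≡M₂) p)) v∉F₁
    where
    u = proj₁ (to (∈-covered {M = M₂}) v∈F₂)
    p = proj₂ (to (∈-covered {M = M₂}) v∈F₂)
    unmatched : ∀ {u v′ u′} → T (M₂ u v) → T (M₂ u v′) → ¬ T (M₁ u′ v′)
    unmatched p p′ q with refl ← rows₂ _ _ _ p p′ = v∉F₁ (from (∈-covered {M = M₁}) (_ , q))
    M₁≡M₂ : M₁ u v ≡ M₂ u v
    M₁≡M₂ = agree-from (M₂⊆U₂ _ v) unmatched p v

  saturates-mono : U₁ ⊆ dom M₁ → U₂ ⊆ dom M₂
  saturates-mono U₁⊆dom {u} u∈U₂ with u ∈? dom M₂
  ... | yes u∈dom = u∈dom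
  ... | no  u∉dom = contradiction (from (∈-dom {M = M₂}) (v , subst T M₁≡M₂ p)) u∉dom
    where
    v = proj₁ (to (∈-dom {M = M₁}) (U₁⊆dom (U₂⊆U₁ u∈U₂)))
    p = proj₂ (to (∈-dom {M = M₁}) (U₁⊆dom (U₂⊆U₁ u∈U₂)))
    M₁≡M₂ : M₁ u v ≡ M₂ u v
    M₁≡M₂ = agree-from {Start = _≡ u} (λ { refl → u∈U₂ })
                       (λ { refl q _ → u∉dom (from (∈-dom {M = M₂}) (_ , q)) }) refl v

lemma2 : ∀ {c ℓ₁ ℓ₂} (W : OrderedAbelianGroup c ℓ₁ ℓ₂) {m n : _}
           (E : EdgeSet m n) (w : Fin m → Fin n → OrderedAbelianGroup.Carrier W) →
           DistinctWeights W E w →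
           (U₁ U₂ : Subset m) (M₁ M₂ : EdgeSet m n) →
           IsMaxWeightMatching W E w U₁ M₁ →
           IsMaxWeightMatching W E w U₂ M₂ →
           U₂ ⊆ U₁ →
           (covered M₂ ⊆ covered M₁) × (∣ covered M₁ ∣ ≡ ∣ U₁ ∣ → ∣ covered M₂ ∣ ≡ ∣ U₂ ∣)
lemma2 W E w distinct U₁ U₂ M₁ M₂ max₁ max₂ U₂⊆U₁ =
  covered-mono ,
  λ ∣F₁∣≡∣U₁∣ → U⊆dom⇒∣covered∣≡∣U∣ (proj₁ max₂)
                  (saturates-mono (∣covered∣≡∣U∣⇒U⊆dom (proj₁ max₁) ∣F₁∣≡∣U₁∣))
  where open MaxWeightMatchings W distinct max₁ max₂ U₂⊆U₁
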